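{- If a graph $G$ has a consistent $(p\!:\!q)$-colouring with clustering $c_1$, and a graph $H$ has a $(q\!:\!r)$-colouring with clustering $c_2$, then $G\boxtimes H$ has a $(p\!:\!r)$-colouring with clustering $c_1c_2$.
   Context: $\boxtimes$ is the strong product (vertex set $V(A)\times V(B)$; distinct $(v,x),(w,y)$ adjacent iff ($v=w$, $xy\in E(B)$) or ($x=y$, $vw\in E(A)$) or ($vw\in E(A)$, $xy\in E(B)$)). A $(p\!:\!q)$-colouring $\alpha$ assigns to each vertex a $q$-subset of a palette of $p$ colours. It is consistent if for each vertex $x$ there is an ordering $\alpha_x^1,\dots,\alpha_x^q$ of $\alpha(x)$ such that $\alpha_x^i\ne\alpha_y^j$ for every edge $xy$ and all distinct $i,j\in[1,q]$. For a colour $\beta$, a monochromatic component is a connected component of the subgraph induced by the vertices whose set contains $\beta$; clustering $c$ means every monochromatic component has at most $c$ vertices. -}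

module Defs where

open import Data.Nat using (ℕ; _≤_)
open import Data.Fin using (Fin)
open import Data.Fin.Subset using (Subset; _∈_; ∣_∣)
open import Data.Product using (Σ; _×_; _,_; proj₁; proj₂)
open import Data.Sum using (_⊎_; inj₁; inj₂)
open import Data.Empty using (⊥)
open import Data.List using (List; length)
open import Data.List.Relation.Unary.All using (All)
open import Data.List.Relation.Unary.Unique.Propositional using (Unique)
open import Relation.Nullary using (¬_)
open import Relation.Binary.PropositionalEquality using (_≡_; refl; sym)
open import Function.Definitions using (Injective)

record Graph : Set₁ where
  field
    V     : Set
    E     : V → V → Set
    E-sym : ∀ {u v} → E u v → E v u
    E-irr : ∀ {u} → ¬ E u u
open Graph public

_⊠_ : Graph → Graph → Graph
A ⊠ B = record
  { V = V A × V B
  ; E = λ { (v , x) (w , y) →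
        (v ≡ w × E B x y) ⊎ ((x ≡ y × E A v w) ⊎ (E A v w × E B x y)) }
  ; E-sym = λ { (inj₁ (p , e)) → inj₁ (sym p , E-sym B e)
              ; (inj₂ (inj₁ (p , e))) → inj₂ (inj₁ (sym p , E-sym A e))
              ; (inj₂ (inj₂ (e , f))) → inj₂ (inj₂ (E-sym A e , E-sym B f)) }
  ; E-irr = λ { (inj₁ (_ , e)) → E-irr B e
              ; (inj₂ (inj₁ (_ , e))) → E-irr A e
              ; (inj₂ (inj₂ (e , _))) → E-irr A e }
  }

record Colouring (G : Graph) (p q : ℕ) : Set where
  field
    col  : V G → Subset p
    size : ∀ v → ∣ col v ∣ ≡ q
open Colouring public

-- Consistency: for each vertex x an ordering α_x^1..α_x^q of α(x)
-- (an injective map Fin q → Fin p with image inside α(x), hence onto α(x)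
-- since |α(x)| = q) such that α_x^i ≠ α_y^j for every edge xy and i ≠ j.
Consistent : {G : Graph} {p q : ℕ} → Colouring G p q → Set
Consistent {G} {p} {q} α =
  Σ (V G → Fin q → Fin p) λ ord →
    (∀ x → Injective _≡_ _≡_ (ord x)) ×
    (∀ x i → ord x i ∈ col α x) ×
    (∀ x y → E G x y → ∀ (i j : Fin q) → ¬ i ≡ j → ¬ ord x i ≡ ord y j)

-- u and v lie in the same monochromatic component of colour β: there is a
-- path from u to v all of whose vertices have β in their colour set.
data MonoConn {G : Graph} {p q : ℕ} (α : Colouring G p q) (β : Fin p)
       : V G → V G → Set where
  here : ∀ {u} → β ∈ col α u → MonoConn α β u u
  step : ∀ {u w v} → β ∈ col α u → E G u w → MonoConn α β w v →
         MonoConn α β u v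

-- Clustering c: every monochromatic component has at most c vertices,
-- i.e. any list of distinct vertices in the component of v has length ≤ c.
Clustering : {G : Graph} {p q : ℕ} → Colouring G p q → ℕ → Set
Clustering {G} {p} α c =
  ∀ (β : Fin p) (v : V G) (xs : List (V G)) →
    Unique xs → All (MonoConn α β v) xs → length xs ≤ c

-- Colour (v , x) by δ(v , x) = {α_v^i : i ∈ γ(x)}, using the consistent orderings α_v^1 … α_v^q
-- of α. Along an edge of G ⊠ H the index i with α_v^i = β cannot change, because adjacent (or
-- equal) vertices of G never share a colour at distinct indices. So a β-monochromatic path of δ
-- from (v , x) projects to a β-monochromatic path of α in G and an i-monochromatic path of γ in H,
-- and a δ-component lies inside the product of a component of size ≤ c₁ and one of size ≤ c₂.
module Submission where

open import Defs
open import Data.Nat using (ℕ; zero; suc; _+_; _*_; _≤_; z≤n; s≤s⁻¹; _≤?_)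
open import Data.Nat.Properties using (+-mono-≤; module ≤-Reasoning)
open import Data.Fin using (Fin; zero; suc; _≟_)
open import Data.Fin.Properties using (suc-injective)
open import Data.Fin.Subset using (Subset; _∈_; _∉_; ∣_∣; ⊥; ⁅_⁆; _∪_; inside; outside)
open import Data.Fin.Subset.Properties using (∉⊥; ∣⊥∣≡0; ∪-identityˡ; x∈p∪q⁻; x∈⁅y⁆⇒x≡y)
open import Data.Product using (Σ; ∃; ∃₂; _×_; _,_; proj₁; proj₂)
open import Data.Vec as Vec using ([]; _∷_)
open import Data.List using (List; []; _∷_; _++_; map; length)
open import Data.List.Properties using (length-++; length-map)
open import Data.List.Relation.Unary.All as All using (All; []; _∷_)
import Data.List.Relation.Unary.All.Properties as All
open import Data.List.Relation.Unary.Unique.Propositional using (Unique; []; _∷_)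
import Data.List.Relation.Unary.Unique.Propositional.Properties as Unique
open import Data.List.Relation.Binary.Permutation.Propositional
  using (_↭_; ↭-refl; ↭-prep; ↭-trans; ↭-sym; ↭⇒↭ₛ)
open import Data.List.Relation.Binary.Permutation.Propositional.Properties
  using (↭-length; All-resp-↭; shift)
import Data.List.Relation.Binary.Permutation.Setoid.Properties as PermutationSetoid
open import Data.Sum using (inj₁; inj₂)
open import Effect.Monad using (RawMonad)
open import Function using (_∘_)
open import Level using (0ℓ)
open import Function.Definitions using (Injective)
open import Relation.Binary.Construct.Closure.Reflexive using (ReflClosure; refl; [_])
open import Relation.Binary.PropositionalEquality
  using (_≡_; _≢_; refl; sym; trans; cong; subst; setoid; ≢-sym; module ≡-Reasoning)
open import Relation.Nullary using (¬_; Dec; yes; no; contradiction)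
open import Relation.Nullary.Decidable using (decidable-stable; ¬¬-excluded-middle)
open import Relation.Nullary.Negation using (¬¬-Monad)
open import Relation.Unary using (Pred; _⊆_; _∩_; _⟨×⟩_)

image : ∀ {p q} → (Fin q → Fin p) → Subset q → Subset p
image f []            = ⊥
image f (outside ∷ s) = image (f ∘ suc) s
image f (inside ∷ s)  = ⁅ f zero ⁆ ∪ image (f ∘ suc) s

∈-image⁻ : ∀ {p q} (f : Fin q → Fin p) s {y} → y ∈ image f s → ∃ λ i → i ∈ s × f i ≡ y
∈-image⁻ f []            y∈ = contradiction y∈ ∉⊥
∈-image⁻ f (outside ∷ s) y∈ with i , i∈s , fi≡y ← ∈-image⁻ (f ∘ suc) s y∈ =
  suc i , Vec.there i∈s , fi≡y
∈-image⁻ f (inside ∷ s)  y∈ with x∈p∪q⁻ ⁅ f zero ⁆ (image (f ∘ suc) s) y∈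
... | inj₁ y∈⁅f0⁆ = zero , Vec.here , sym (x∈⁅y⁆⇒x≡y (f zero) y∈⁅f0⁆)
... | inj₂ y∈rest with i , i∈s , fi≡y ← ∈-image⁻ (f ∘ suc) s y∈rest =
  suc i , Vec.there i∈s , fi≡y

∣⁅x⁆∪p∣≡1+∣p∣ : ∀ {n} (x : Fin n) (p : Subset n) → x ∉ p → ∣ ⁅ x ⁆ ∪ p ∣ ≡ suc ∣ p ∣
∣⁅x⁆∪p∣≡1+∣p∣ zero    (inside ∷ p)  x∉p = contradiction Vec.here x∉p
∣⁅x⁆∪p∣≡1+∣p∣ zero    (outside ∷ p) x∉p = cong (suc ∘ ∣_∣) (∪-identityˡ p)
∣⁅x⁆∪p∣≡1+∣p∣ (suc x) (inside ∷ p)  x∉p =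
  cong suc (∣⁅x⁆∪p∣≡1+∣p∣ x p (x∉p ∘ Vec.there))
∣⁅x⁆∪p∣≡1+∣p∣ (suc x) (outside ∷ p) x∉p = ∣⁅x⁆∪p∣≡1+∣p∣ x p (x∉p ∘ Vec.there)

∣image∣≡∣s∣ : ∀ {p q} {f : Fin q → Fin p} → Injective _≡_ _≡_ f → ∀ s → ∣ image f s ∣ ≡ ∣ s ∣
∣image∣≡∣s∣ {p} f-inj []            = ∣⊥∣≡0 p
∣image∣≡∣s∣     f-inj (outside ∷ s) = ∣image∣≡∣s∣ (suc-injective ∘ f-inj) s
∣image∣≡∣s∣ {f = f} f-inj (inside ∷ s) = begin
  ∣ ⁅ f zero ⁆ ∪ image (f ∘ suc) s ∣ ≡⟨ ∣⁅x⁆∪p∣≡1+∣p∣ (f zero) _ f0∉rest ⟩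
  suc ∣ image (f ∘ suc) s ∣          ≡⟨ cong suc (∣image∣≡∣s∣ (suc-injective ∘ f-inj) s) ⟩
  suc ∣ s ∣                          ∎
  where
  open ≡-Reasoning
  f0∉rest : f zero ∉ image (f ∘ suc) s
  f0∉rest f0∈ with _ , _ , fsi≡f0 ← ∈-image⁻ (f ∘ suc) s f0∈ with () ← f-inj fsi≡f0

-- Clustering α c unfolds to ∀ β v → AtMost c (MonoConn α β v).
AtMost : {A : Set} → ℕ → Pred A 0ℓ → Set
AtMost {A} c P = (xs : List A) → Unique xs → All P xs → length xs ≤ c

module _ {A : Set} where

  AtMost-mono : ∀ {c} {P Q : Pred A 0ℓ} → P ⊆ Q → AtMost c Q → AtMost c P
  AtMost-mono P⊆Q Q≤c xs xs! Pxs = Q≤c xs xs! (All.map P⊆Q Pxs)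

  AtMost-remove : ∀ {c} {P : Pred A 0ℓ} {a} → P a → AtMost (suc c) P → AtMost c (P ∩ (_≢ a))
  AtMost-remove {a = a} Pa P≤1+c xs xs! P≢xs =
    s≤s⁻¹ (P≤1+c (a ∷ xs) (All.map (≢-sym ∘ proj₂) P≢xs ∷ xs!) (Pa ∷ All.map proj₁ P≢xs))

  Unique-resp-↭ : ∀ {xs ys : List A} → xs ↭ ys → Unique xs → Unique ys
  Unique-resp-↭ = PermutationSetoid.Unique-resp-↭ (setoid A) ∘ ↭⇒↭ₛ

  Unique-++⁻ : ∀ (xs : List A) {ys} → Unique (xs ++ ys) → Unique xs × Unique ys
  Unique-++⁻ []       ys!          = [] , ys!
  Unique-++⁻ (x ∷ xs) (x∉ ∷ xsys!) with xs! , ys! ← Unique-++⁻ xs xsys! =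
    All.++⁻ˡ xs x∉ ∷ xs! , ys!

module _ {A B : Set} where

  open RawMonad (¬¬-Monad {a = 0ℓ}) using (pure; _>>=_)

  FibreSplit : A → List (A × B) → Set
  FibreSplit a zs = ∃₂ λ bs ws → zs ↭ map (a ,_) bs ++ ws × All (λ w → proj₁ w ≢ a) ws

  -- Equality on A is not decidable; deciding it for each of the finitely many zs is only possible
  -- under double negation, which suffices since the bound we prove is a decidable statement.
  ¬¬-fibreSplit : ∀ a zs → ¬ ¬ FibreSplit a zs
  ¬¬-fibreSplit a []              = pure ([] , [] , ↭-refl , [])
  ¬¬-fibreSplit a ((a′ , b) ∷ zs) = do
      split ← ¬¬-fibreSplit a zs
      a′≟a  ← ¬¬-excluded-middle
      pure (extend a′≟a split)
    where
    extend : Dec (a′ ≡ a) → FibreSplit a zs → FibreSplit a ((a′ , b) ∷ zs)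
    extend (yes refl) (bs , ws , zs↭ , ws≢a) = b ∷ bs , ws , ↭-prep (a , b) zs↭ , ws≢a
    extend (no a′≢a)  (bs , ws , zs↭ , ws≢a) =
      bs , (a′ , b) ∷ ws , ↭-trans (↭-prep _ zs↭) (↭-sym (shift _ (map (a ,_) bs) ws)) , a′≢a ∷ ws≢a

  AtMost-⟨×⟩ : ∀ {m n} {P : Pred A 0ℓ} {Q : Pred B 0ℓ} →
               AtMost m P → AtMost n Q → AtMost (m * n) (P ⟨×⟩ Q)
  AtMost-⟨×⟩               P≤m Q≤n []              _   _               = z≤n
  AtMost-⟨×⟩ {zero}        P≤m Q≤n ((a , _) ∷ _)   _   ((Pa , _) ∷ _)  =
    contradiction (P≤m (a ∷ []) ([] ∷ []) (Pa ∷ [])) λ ()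
  AtMost-⟨×⟩ {suc m} {n} {P} {Q} P≤1+m Q≤n zs@((a , _) ∷ _) zs! PQzs@((Pa , _) ∷ _) =
    decidable-stable (length zs ≤? suc m * n) (λ ≰ → ¬¬-fibreSplit a zs (≰ ∘ bound))
    where
    bound : FibreSplit a zs → length zs ≤ n + m * n
    bound (bs , ws , zs↭ , ws≢a) = begin
      length zs                          ≡⟨ ↭-length zs↭ ⟩
      length (map (a ,_) bs ++ ws)       ≡⟨ length-++ (map (a ,_) bs) ⟩
      length (map (a ,_) bs) + length ws ≡⟨ cong (_+ length ws) (length-map (a ,_) bs) ⟩
      length bs + length ws              ≤⟨ +-mono-≤ (Q≤n bs bs! (All.map proj₂ PQbs)) ws≤m*n ⟩
      n + m * n                          ∎
      where
      open ≤-Reasoning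
      fibre!,ws! : Unique (map (a ,_) bs) × Unique ws
      fibre!,ws! = Unique-++⁻ (map (a ,_) bs) (Unique-resp-↭ zs↭ zs!)
      bs! : Unique bs
      bs! = Unique.map⁻ (proj₁ fibre!,ws!)
      PQfibre,PQws : All (P ⟨×⟩ Q) (map (a ,_) bs) × All (P ⟨×⟩ Q) ws
      PQfibre,PQws = All.++⁻ (map (a ,_) bs) (All-resp-↭ zs↭ PQzs)
      PQbs : All (λ b → P a × Q b) bs
      PQbs = All.map⁻ (proj₁ PQfibre,PQws)
      ws≤m*n : length ws ≤ m * n
      ws≤m*n = AtMost-⟨×⟩ (AtMost-remove Pa P≤1+m) Q≤n ws (proj₂ fibre!,ws!)
        (All.zipWith (λ { ((Pw , Qw) , w≢a) → (Pw , w≢a) , Qw }) (proj₂ PQfibre,PQws , ws≢a))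

⊠-edge⇒closures : ∀ {G H : Graph} {v w x y} → E (G ⊠ H) (v , x) (w , y) →
                  ReflClosure (E G) v w × ReflClosure (E H) x y
⊠-edge⇒closures (inj₁ (refl , x∼y))      = refl , [ x∼y ]
⊠-edge⇒closures (inj₂ (inj₁ (refl , v∼w))) = [ v∼w ] , refl
⊠-edge⇒closures (inj₂ (inj₂ (v∼w , x∼y)))  = [ v∼w ] , [ x∼y ]

module _ {G : Graph} {p q} {α : Colouring G p q} {β : Fin p} where

  MonoConn-source : ∀ {u v} → MonoConn α β u v → β ∈ col α u
  MonoConn-source (here β∈)     = β∈
  MonoConn-source (step β∈ _ _) = β∈

  MonoConn-prepend : ∀ {u w t} → β ∈ col α u → ReflClosure (E G) u w → MonoConn α β w t →
                     MonoConn α β u t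
  MonoConn-prepend β∈ refl    path = path
  MonoConn-prepend β∈ [ u∼w ] path = step β∈ u∼w path

module ProductColouring {G H : Graph} {p q r : ℕ} (α : Colouring G p q) (γ : Colouring H q r)
  (ord : V G → Fin q → Fin p) (ord-injective : ∀ v → Injective _≡_ _≡_ (ord v))
  (ord-∈ : ∀ v i → ord v i ∈ col α v)
  (ord-proper : ∀ v w → E G v w → ∀ i j → i ≢ j → ord v i ≢ ord w j) where

  δ : Colouring (G ⊠ H) p r
  col  δ (v , x) = image (ord v) (col γ x)
  size δ (v , x) = trans (∣image∣≡∣s∣ (ord-injective v) (col γ x)) (size γ x)

  ord-index-unique : ∀ {v w i j} → ReflClosure (E G) v w → ord v i ≡ ord w j → i ≡ j
  ord-index-unique {v}     refl    = ord-injective v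
  ord-index-unique {v} {w} {i} {j} [ v∼w ] vi≡wj =
    decidable-stable (i ≟ j) (λ i≢j → ord-proper v w v∼w i j i≢j vi≡wj)

  δ-index-∈ : ∀ {v x i β} → ord v i ≡ β → β ∈ col δ (v , x) → i ∈ col γ x
  δ-index-∈ {v} {x} vi≡β β∈ with j , j∈ , vj≡β ← ∈-image⁻ (ord v) (col γ x) β∈
    with refl ← ord-injective v (trans vi≡β (sym vj≡β)) = j∈

  δ-path-projection : ∀ {v x w y i β} → ord v i ≡ β → MonoConn δ β (v , x) (w , y) →
                      MonoConn α β v w × MonoConn γ i x y
  δ-path-projection {v} {i = i} vi≡β (here β∈) =
    here (subst (_∈ col α v) vi≡β (ord-∈ v i)) , here (δ-index-∈ vi≡β β∈)
  δ-path-projection {v} {i = i} vi≡β (step {w = w′ , y′} β∈ vx∼wy path)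
    with v⁼w′ , x⁼y′ ← ⊠-edge⇒closures {G} {H} vx∼wy
    with j , _ , w′j≡β ← ∈-image⁻ (ord w′) (col γ y′) (MonoConn-source path)
    with refl ← ord-index-unique v⁼w′ (trans vi≡β (sym w′j≡β))
    with pathα , pathγ ← δ-path-projection w′j≡β path =
      MonoConn-prepend (subst (_∈ col α v) vi≡β (ord-∈ v i)) v⁼w′ pathα ,
      MonoConn-prepend (δ-index-∈ vi≡β β∈) x⁼y′ pathγ

  δ-clustering : ∀ {c₁ c₂} → Clustering α c₁ → Clustering γ c₂ → Clustering δ (c₁ * c₂)
  δ-clustering clα clγ β _        []            _   _ = z≤n
  δ-clustering clα clγ β (v , x) ts@(_ ∷ _) ts! paths@(path ∷ _)
    with i , _ , vi≡β ← ∈-image⁻ (ord v) (col γ x) (MonoConn-source path) =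
      AtMost-mono (δ-path-projection vi≡β) (AtMost-⟨×⟩ (clα β v) (clγ i x)) ts ts! paths

mainTheorem6 : (G H : Graph) (p q r c₁ c₂ : ℕ) →
    (α : Colouring G p q) → Consistent α → Clustering α c₁ →
    (γ : Colouring H q r) → Clustering γ c₂ →
    Σ (Colouring (G ⊠ H) p r) λ δ → Clustering δ (c₁ * c₂)
mainTheorem6 G H p q r c₁ c₂ α (ord , ord-injective , ord-∈ , ord-proper) clα γ clγ =
  δ , δ-clustering clα clγ
  where open ProductColouring α γ ord ord-injective ord-∈ ord-proper
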